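{- For every integer $k\ge 2$, $r(k,k)=2k-1$.
   Context: For a graph whose edges are coloured red and blue, a red (resp. blue) $t$-connected matching is a connected component of the spanning subgraph formed by the red (resp. blue) edges whose maximum matching has size at least $t$. For positive integers $k,l$, $r(k,l)$ denotes the smallest integer $n$ such that every red-blue colouring of the edges of $K_{n,n}$ contains a red $k$-connected matching or a blue $l$-connected matching. -}

module Defs where

open import Data.Nat using (ℕ; _<_)
open import Data.Fin using (Fin)
open import Data.Bool using (Bool; true; false)
open import Data.Sum using (_⊎_; inj₁; inj₂)
open import Data.Product using (Σ; _×_; ∃; ∃-syntax)
open import Relation.Binary.PropositionalEquality using (_≡_)
open import Relation.Binary.Construct.Closure.ReflexiveTransitive using (Star)
open import Relation.Nullary using (¬_)
open import Function.Definitions using (Injective)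

Colour : Set
Colour = Bool

red blue : Colour
red = true
blue = false

-- A red-blue edge colouring of K_{n,n}: left part Fin n, right part Fin n,
-- every pair (i , j) is an edge, coloured col i j.
Colouring : ℕ → Set
Colouring n = Fin n → Fin n → Colour

Vertex : ℕ → Set
Vertex n = Fin n ⊎ Fin n

data Adj {n : ℕ} (col : Colouring n) (c : Colour) : Vertex n → Vertex n → Set where
  lr : ∀ {i j} → col i j ≡ c → Adj col c (inj₁ i) (inj₂ j)
  rl : ∀ {i j} → col i j ≡ c → Adj col c (inj₂ j) (inj₁ i)

Conn : {n : ℕ} → Colouring n → Colour → Vertex n → Vertex n → Set
Conn col c = Star (Adj col c)

-- The colour-c subgraph has a t-connected matching: some connected component
-- (the one containing vertex v) contains a matching of size t, i.e. t edges
-- (l a , r a) of colour c with pairwise distinct left and pairwise distinct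
-- right endpoints, all lying in that component.
HasConnMatching : {n : ℕ} → Colouring n → Colour → ℕ → Set
HasConnMatching {n} col c t =
  Σ (Vertex n) λ v → Σ (Fin t → Fin n) λ l → Σ (Fin t → Fin n) λ r →
    (Injective _≡_ _≡_ l × Injective _≡_ _≡_ r ×
     ((a : Fin t) → col (l a) (r a) ≡ c × Conn col c (inj₁ (l a)) v))

Arrows : ℕ → ℕ → ℕ → Set
Arrows n k l = (col : Colouring n) → HasConnMatching col red k ⊎ HasConnMatching col blue l

RamseyNumberIs : ℕ → ℕ → ℕ → Set
RamseyNumberIs k l n = Arrows n k l × ((m : ℕ) → m < n → ¬ Arrows m k l)

-- Upper bound: in a colouring of K_{2k-1,2k-1} every left vertex has red or blue degree at
-- least k, so some colour c has k left vertices of c-degree at least k.  Any two of them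
-- have a common c-neighbour (k + k > 2k - 1), so they lie in one c-component, and since
-- each has at least k c-neighbours they can be matched greedily to distinct right vertices.
-- Lower bound: on K_{m,m} with m ≤ 2k - 2, colour the first k - 1 rows red and the rest
-- blue; a monochromatic matching then has at most k - 1 distinct left endpoints.
module Submission where

open import Defs
open import Data.Nat using (ℕ; zero; suc; _+_; _*_; _∸_; _≤_; _<_; _≤ᵇ_; _<ᵇ_; z≤n; s≤s; _≤?_)
open import Data.Nat.Properties
  using ( +-suc; +-comm; +-identityʳ; +-mono-≤; +-monoˡ-≤; +-cancelˡ-<; m+[n∸m]≡n; ∸-cancelʳ-≡
        ; ≤-trans; ≤-reflexive; ≤-pred; <⇒≤; <-≤-trans; m≤n⇒m≤1+n; <⇒≱; ≰⇒>; ≮⇒≥; 1+n≰n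
        ; ≤ᵇ⇒≤; ≤⇒≤ᵇ; <ᵇ⇒<; <⇒<ᵇ; module ≤-Reasoning )
open import Data.Fin using (Fin; zero; suc; toℕ; fromℕ<; inject≤)
open import Data.Fin.Properties
  using (suc-injective; any?; ¬∀⟶∃¬; injective⇒≤; inject≤-injective; toℕ-injective; toℕ-fromℕ<; toℕ<n; _≟_)
open import Data.Bool using (Bool; true; false; not; if_then_else_; T)
open import Data.Bool.Properties using (T-≡; T-not-≡; T?)
open import Data.Unit using (tt)
open import Data.Empty using (⊥-elim)
open import Data.Sum using (_⊎_; inj₁; inj₂)
import Data.Sum as Sum
open import Data.Product using (Σ; ∃; _×_; _,_; proj₁; proj₂)
open import Function using (_∘_; Equivalence)
open import Function.Definitions using (Injective)
open import Relation.Binary.PropositionalEquality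
open import Relation.Binary.Construct.Closure.ReflexiveTransitive using (ε; _◅_)
open import Relation.Nullary using (¬_; yes; no)
open import Relation.Nullary.Decidable using (_×-dec_)

private
  variable
    n t : ℕ

count : (Fin n → Bool) → ℕ
count {zero}  P = 0
count {suc n} P = if P zero then suc (count (P ∘ suc)) else count (P ∘ suc)

count-complement : (P : Fin n → Bool) → count P + count (not ∘ P) ≡ n
count-complement {zero}  P = refl
count-complement {suc n} P with P zero | count-complement (P ∘ suc)
... | true  | ih = cong suc ih
... | false | ih = trans (+-suc _ _) (cong suc ih)

count-mono : (P Q : Fin n → Bool) → (∀ j → T (P j) → T (Q j)) → count P ≤ count Q
count-mono {zero}  P Q P⊆Q = z≤n
count-mono {suc n} P Q P⊆Q with P zero | Q zero | P⊆Q zero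
... | true  | true  | _ = s≤s (count-mono (P ∘ suc) (Q ∘ suc) (P⊆Q ∘ suc))
... | false | true  | _ = m≤n⇒m≤1+n (count-mono (P ∘ suc) (Q ∘ suc) (P⊆Q ∘ suc))
... | false | false | _ = count-mono (P ∘ suc) (Q ∘ suc) (P⊆Q ∘ suc)
... | true  | false | P₀⇒Q₀ = ⊥-elim (P₀⇒Q₀ tt)

enumerate : (P : Fin n → Bool) →
  Σ (Fin (count P) → Fin n) λ e → Injective _≡_ _≡_ e × (∀ b → T (P (e b)))
enumerate {zero}  P = (λ ()) , (λ { {()} }) , (λ ())
enumerate {suc n} P with P zero in P₀ | enumerate (P ∘ suc)
... | false | e , e-inj , e∈P = suc ∘ e , e-inj ∘ suc-injective , e∈P
... | true  | e , e-inj , e∈P = e′ , e′-inj , e′∈P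
  where
  e′ : Fin (suc (count (P ∘ suc))) → Fin (suc n)
  e′ zero    = zero
  e′ (suc b) = suc (e b)
  e′-inj : Injective _≡_ _≡_ e′
  e′-inj {zero}  {zero}  _  = refl
  e′-inj {suc a} {suc b} eq = cong suc (e-inj (suc-injective eq))
  e′∈P : ∀ b → T (P (e′ b))
  e′∈P zero    = Equivalence.from T-≡ P₀
  e′∈P (suc b) = e∈P b

select : (P : Fin n → Bool) → t ≤ count P →
  Σ (Fin t → Fin n) λ e → Injective _≡_ _≡_ e × (∀ a → T (P (e a)))
select P t≤∣P∣ with enumerate P
... | e , e-inj , e∈P = e ∘ ι , (λ eq → ι-inj (e-inj eq)) , e∈P ∘ ι
  where
  ι : Fin _ → Fin (count P)
  ι a = inject≤ a t≤∣P∣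
  ι-inj : Injective _≡_ _≡_ ι
  ι-inj = inject≤-injective t≤∣P∣ t≤∣P∣ _ _

common-element : (P Q : Fin n → Bool) → n < count P + count Q → ∃ λ j → T (P j) × T (Q j)
common-element P Q n<∣P∣+∣Q∣ with any? (λ j → T? (P j) ×-dec T? (Q j))
... | yes found    = found
... | no  disjoint = ⊥-elim (<⇒≱ n<∣P∣+∣Q∣ ∣P∣+∣Q∣≤n)
  where
  P⊆∁Q : ∀ j → T (P j) → T (not (Q j))
  P⊆∁Q j Pj with Q j in Qj
  ... | true  = ⊥-elim (disjoint (j , Pj , Equivalence.from T-≡ Qj))
  ... | false = tt
  ∣P∣+∣Q∣≤n : count P + count Q ≤ _
  ∣P∣+∣Q∣≤n = begin
    count P + count Q         ≤⟨ +-monoˡ-≤ (count Q) (count-mono P (not ∘ Q) P⊆∁Q) ⟩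
    count (not ∘ Q) + count Q ≡⟨ +-comm (count (not ∘ Q)) (count Q) ⟩
    count Q + count (not ∘ Q) ≡⟨ count-complement Q ⟩
    _                         ∎
    where open ≤-Reasoning

fresh : (g : Fin t → Fin n) (P : Fin n → Bool) → t < count P →
  ∃ λ j → T (P j) × (∀ a → g a ≢ j)
fresh g P t<∣P∣ with enumerate P
... | e , e-inj , e∈P =
  let b , uncovered = ¬∀⟶∃¬ _ _ (λ b → any? λ a → g a ≟ e b) not-covered
  in e b , e∈P b , λ a ga≡eb → uncovered (a , ga≡eb)
  where
  not-covered : ¬ (∀ b → ∃ λ a → g a ≡ e b)
  not-covered cover = <⇒≱ t<∣P∣ (injective⇒≤ {f = proj₁ ∘ cover} λ {b} {b′} eq →
    e-inj (trans (sym (proj₂ (cover b))) (trans (cong g eq) (proj₂ (cover b′)))))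

distinct-representatives : (N : Fin t → Fin n → Bool) → (∀ a → t ≤ count (N a)) →
  Σ (Fin t → Fin n) λ r → Injective _≡_ _≡_ r × (∀ a → T (N a (r a)))
distinct-representatives {zero}  N _ = (λ ()) , (λ { {()} }) , (λ ())
distinct-representatives {suc t} N large
  with distinct-representatives (N ∘ suc) (λ a → <⇒≤ (large (suc a)))
... | r , r-inj , r∈N with fresh r (N zero) (large zero)
... | j , j∈N₀ , j∉r = r′ , r′-inj , r′∈N
  where
  r′ : Fin (suc t) → Fin _
  r′ zero    = j
  r′ (suc a) = r a
  r′-inj : Injective _≡_ _≡_ r′
  r′-inj {zero}  {zero}  _  = refl
  r′-inj {zero}  {suc b} eq = ⊥-elim (j∉r b (sym eq))
  r′-inj {suc a} {zero}  eq = ⊥-elim (j∉r a eq)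
  r′-inj {suc a} {suc b} eq = cong suc (r-inj eq)
  r′∈N : ∀ a → T (N a (r′ a))
  r′∈N zero    = j∈N₀
  r′∈N (suc a) = r∈N a

neighbours : Colouring n → Colour → Fin n → Fin n → Bool
neighbours col c i j = if c then col i j else not (col i j)

degree : Colouring n → Colour → Fin n → ℕ
degree col c i = count (neighbours col c i)

neighbours-colour : (col : Colouring n) (c : Colour) {i j : Fin n} →
  T (neighbours col c i j) → col i j ≡ c
neighbours-colour col true  = Equivalence.to T-≡
neighbours-colour col false = Equivalence.to T-not-≡

connected-matching : (col : Colouring n) (c : Colour) → n < t + t →
  (x : Fin t → Fin n) → Injective _≡_ _≡_ x → (∀ a → t ≤ degree col c (x a)) →
  HasConnMatching col c t
connected-matching {t = zero}  col c ()
connected-matching {t = suc t} col c n<2t x x-inj x-large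
  with distinct-representatives (neighbours col c ∘ x) x-large
... | r , r-inj , r∈N =
  inj₁ (x zero) , x , r , x-inj , r-inj , λ a → neighbours-colour col c (r∈N a) , path a
  where
  path : ∀ a → Conn col c (inj₁ (x a)) (inj₁ (x zero))
  path a with common-element (neighbours col c (x a)) (neighbours col c (x zero))
                (<-≤-trans n<2t (+-mono-≤ (x-large a) (x-large zero)))
  ... | j , xa~j , x₀~j = lr (neighbours-colour col c xa~j) ◅ rl (neighbours-colour col c x₀~j) ◅ ε

rich-vertices⇒connected-matching : (col : Colouring n) (c : Colour) → n < t + t →
  t ≤ count (λ i → t ≤ᵇ degree col c i) → HasConnMatching col c t
rich-vertices⇒connected-matching {t = t} col c n<2t many-rich =
  let x , x-inj , x-rich = select _ many-rich
  in connected-matching col c n<2t x x-inj (λ a → ≤ᵇ⇒≤ t _ (x-rich a))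

majority : ∀ {k} (P : Fin (suc (k + k)) → Bool) → suc k ≤ count P ⊎ suc k ≤ count (not ∘ P)
majority {k} P with suc k ≤? count P | suc k ≤? count (not ∘ P)
... | yes many | _        = inj₁ many
... | no  _    | yes many = inj₂ many
... | no  few  | no  few∁ = ⊥-elim (1+n≰n (begin
  suc (k + k)               ≡⟨ count-complement P ⟨
  count P + count (not ∘ P) ≤⟨ +-mono-≤ (≤-pred (≰⇒> few)) (≤-pred (≰⇒> few∁)) ⟩
  k + k                     ∎))
  where open ≤-Reasoning

arrows : ∀ k → Arrows (suc (k + k)) (suc k) (suc k)
arrows k col = Sum.map
  (rich-vertices⇒connected-matching col red n<2t)
  (λ many-red-poor → rich-vertices⇒connected-matching col blue n<2t
     (≤-trans many-red-poor (count-mono _ _ red-poor⇒blue-rich)))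
  (majority {k} (rich red))
  where
  rich : Colour → Fin (suc (k + k)) → Bool
  rich c i = suc k ≤ᵇ degree col c i
  n<2t : suc (k + k) < suc k + suc k
  n<2t = s≤s (≤-reflexive (sym (+-suc k k)))
  red-poor⇒blue-rich : ∀ i → T (not (rich red i)) → T (rich blue i)
  red-poor⇒blue-rich i red-poor with majority {k} (col i)
  ... | inj₁ red-rich  = ⊥-elim (subst T (Equivalence.to T-not-≡ red-poor) (≤⇒≤ᵇ red-rich))
  ... | inj₂ blue-rich = ≤⇒≤ᵇ blue-rich

injective-into-window : (f : Fin t → Fin n) (a w : ℕ) → Injective _≡_ _≡_ f →
  (∀ x → a ≤ toℕ (f x) × toℕ (f x) < a + w) → t ≤ w
injective-into-window f a w f-inj in-window = injective⇒≤ {f = shift} shift-inj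
  where
  offset-< : ∀ x → toℕ (f x) ∸ a < w
  offset-< x = let a≤fx , fx<a+w = in-window x in
    +-cancelˡ-< a _ w (subst (_< a + w) (sym (m+[n∸m]≡n a≤fx)) fx<a+w)
  shift : Fin _ → Fin w
  shift x = fromℕ< (offset-< x)
  shift-inj : Injective _≡_ _≡_ shift
  shift-inj {x} {y} eq = f-inj (toℕ-injective (∸-cancelʳ-≡ (proj₁ (in-window x)) (proj₁ (in-window y))
    (trans (sym (toℕ-fromℕ< (offset-< x))) (trans (cong toℕ eq) (toℕ-fromℕ< (offset-< y))))))

not-arrows : ∀ k m → m < suc (k + k) → ¬ Arrows m (suc k) (suc k)
not-arrows k m m<2k+1 m-arrows with m-arrows (λ i _ → toℕ i <ᵇ k)
... | inj₁ (_ , l , _ , l-inj , _ , red-edges) = 1+n≰n (injective-into-window l 0 k l-inj λ a →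
  z≤n , <ᵇ⇒< _ _ (Equivalence.from T-≡ (proj₁ (red-edges a))))
... | inj₂ (_ , l , _ , l-inj , _ , blue-edges) = 1+n≰n (injective-into-window l k k l-inj λ a →
  ≮⇒≥ (λ lk → subst T (proj₁ (blue-edges a)) (<⇒<ᵇ lk)) , <-≤-trans (toℕ<n (l a)) (≤-pred m<2k+1))

2*[1+k]∸1≡1+k+k : ∀ k → 2 * suc k ∸ 1 ≡ suc (k + k)
2*[1+k]∸1≡1+k+k k = trans (+-suc k (k + 0)) (cong (λ m → suc (k + m)) (+-identityʳ k))

-- The argument also covers k = 1; the hypothesis only rules out k = 0.
lemma3p1 : (k : ℕ) → 2 ≤ k → RamseyNumberIs k k (2 * k ∸ 1)
lemma3p1 (suc k) _ rewrite 2*[1+k]∸1≡1+k+k k = arrows k , not-arrows k
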